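{- Let $\Lambda=\Lambda(b,\mathcal{F})$ be a BLPR problem with $M^*<2k^*$ having a basic solution $x$, and suppose some free machine has free capacity $1$. Let $p$ be a machine with free capacity $m_p-c_p=1$, let $q$ be a free job with $t_q$ maximal among all free jobs, let $\mathcal{F}'=\mathcal{F}\cup\{(p,q)\}$ and $b'=(b_1,\dots,b_{p-1},b_p+t_q,b_{p+1},\dots,b_k)$. If $b$ is a feasible upper bounding vector of $\Lambda$, then $b'$ is a feasible upper bounding vector of $\Lambda(b',\mathcal{F}')$, i.e. $\Lambda(b',\mathcal{F}')$ is feasible.
   Context: Given a positive integer $k$, positive integers $m_1,\dots,m_k$, non-negative integers $t_1,\dots,t_M$ with $M\le\sum_i m_i$, a real vector $b=(b_1,\dots,b_k)$ (upper bounding vector) and a set $\mathcal{F}\subseteq\{1,\dots,k\}\times\{1,\dots,M\}$, the BLPR problem $\Lambda(b,\mathcal{F})$ is the feasibility problem in real variables $x_{ij}$ ($1\le i\le k$, $1\le j\le M$): $\sum_j x_{ij}t_j\le b_i$ and $\sum_j x_{ij}\le m_i$ for all $i$; $\sum_i x_{ij}=1$ for all $j$; $x_{ij}=1$ for $(i,j)\in\mathcal{F}$; $x_{ij}\ge0$. The vector $b$ is a feasible upper bounding vector if the problem is feasible. A basic solution is a feasible solution that is the unique solution of a set of linearly independent constraints holding with equality. Let $c_i=|\{j:(i,j)\in\mathcal{F}\}|$; $m_i-c_i$ is the free capacity of machine $i$. A job $j$ is free if $(i,j)\notin\mathcal{F}$ for all $i$; a machine $i$ is free if $c_i<m_i$.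 $M^*$, $k^*$ are the numbers of free jobs and free machines. -}

module Defs where

open import Level using (0ℓ)
open import Data.Nat as ℕ using (ℕ; zero; suc)
import Data.Nat.Properties
open import Data.Fin using (Fin; zero; suc; _≟_)
open import Data.Bool using (Bool; true; false; _∨_; _∧_; if_then_else_; not)
open import Data.List using (List; length; lookup)
open import Data.List.Membership.Propositional using (_∈_)
open import Data.Product using (Σ; _×_; _,_)
open import Data.Sum using (_⊎_)
open import Data.Unit using (⊤)
open import Relation.Nullary using (¬_)
open import Relation.Nullary.Decidable using (⌊_⌋)
open import Relation.Binary.PropositionalEquality using (_≡_; _≢_)
open import Algebra.Structures using (IsCommutativeRing)

-- Ordered fields (not in agda-stdlib).  ℝ is an instance; the BLPR
-- problem is stated over an arbitrary ordered field.

record OrderedField : Set₁ where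
  infixl 6 _+_
  infixl 7 _*_
  infix  4 _≤_ _<_
  field
    Carrier : Set
    _+_ _*_ : Carrier → Carrier → Carrier
    -_      : Carrier → Carrier
    0# 1#   : Carrier
    isCommutativeRing : IsCommutativeRing _≡_ _+_ _*_ -_ 0# 1#
    0≢1     : 0# ≢ 1#
    _⁻¹     : Carrier → Carrier
    ⁻¹-inverse : ∀ x → x ≢ 0# → x * (x ⁻¹) ≡ 1#
    _≤_     : Carrier → Carrier → Set
    ≤-refl  : ∀ {x} → x ≤ x
    ≤-trans : ∀ {x y z} → x ≤ y → y ≤ z → x ≤ z
    ≤-antisym : ∀ {x y} → x ≤ y → y ≤ x → x ≡ y
    ≤-total : ∀ x y → x ≤ y ⊎ y ≤ x
    +-mono-≤ : ∀ {x y} z → x ≤ y → x + z ≤ y + z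
    *-nonneg : ∀ {x y} → 0# ≤ x → 0# ≤ y → 0# ≤ x * y

  _<_ : Carrier → Carrier → Set
  x < y = (x ≤ y) × (x ≢ y)

  field
    trichotomy : ∀ x y → x < y ⊎ x ≡ y ⊎ y < x

count : (n : ℕ) → (Fin n → Bool) → ℕ
count zero    P = zero
count (suc n) P = (if P zero then 1 else 0) ℕ.+ count n (λ i → P (suc i))

sumℕ : (n : ℕ) → (Fin n → ℕ) → ℕ
sumℕ zero    f = zero
sumℕ (suc n) f = f zero ℕ.+ sumℕ n (λ i → f (suc i))

module _ {k M : ℕ} (𝓕 : Fin k → Fin M → Bool) where

  c : Fin k → ℕ
  c i = count M (λ j → 𝓕 i j)

  FreeJob : Fin M → Set
  FreeJob j = ∀ i → 𝓕 i j ≡ false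

  freeJob? : Fin M → Bool
  freeJob? j = not (orAll k (λ i → 𝓕 i j))
    where
    orAll : (n : ℕ) → (Fin n → Bool) → Bool
    orAll zero    P = false
    orAll (suc n) P = P zero ∨ orAll n (λ i → P (suc i))

  freeMachine? : (m : Fin k → ℕ) → Fin k → Bool
  freeMachine? m i = ⌊ c i Data.Nat.Properties.<? m i ⌋

  M* : ℕ
  M* = count M freeJob?

  k* : (m : Fin k → ℕ) → ℕ
  k* m = count k (freeMachine? m)

addPair : {k M : ℕ} → (Fin k → Fin M → Bool) → Fin k → Fin M → Fin k → Fin M → Bool
addPair 𝓕 p q i j = 𝓕 i j ∨ (⌊ i ≟ p ⌋ ∧ ⌊ j ≟ q ⌋)

module BLPR (𝔽 : OrderedField) where
  open OrderedField 𝔽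

  fromℕ : ℕ → Carrier
  fromℕ zero    = 0#
  fromℕ (suc n) = 1# + fromℕ n

  sum : (n : ℕ) → (Fin n → Carrier) → Carrier
  sum zero    f = 0#
  sum (suc n) f = f zero + sum n (λ i → f (suc i))

  module _ {k M : ℕ} (m : Fin k → ℕ) (t : Fin M → ℕ) where

    FeasibleSolution : (b : Fin k → Carrier) (𝓕 : Fin k → Fin M → Bool)
                       (x : Fin k → Fin M → Carrier) → Set
    FeasibleSolution b 𝓕 x =
        (∀ i → sum M (λ j → x i j * fromℕ (t j)) ≤ b i)
      × (∀ i → sum M (λ j → x i j) ≤ fromℕ (m i))
      × (∀ j → sum k (λ i → x i j) ≡ 1#)
      × (∀ i j → 𝓕 i j ≡ true → x i j ≡ 1#)
      × (∀ i j → 0# ≤ x i j)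

    Feasible : (b : Fin k → Carrier) (𝓕 : Fin k → Fin M → Bool) → Set
    Feasible b 𝓕 = Σ (Fin k → Fin M → Carrier) (FeasibleSolution b 𝓕)

    -- the constraints of Λ(b, 𝓕), each written as  Σ_{i,j} a_{ij} x_{ij}  (rel)  r
    data Constraint : Set where
      load   : Fin k → Constraint
      card   : Fin k → Constraint
      job    : Fin M → Constraint
      fixed  : Fin k → Fin M → Constraint
      nonneg : Fin k → Fin M → Constraint

    InProblem : (𝓕 : Fin k → Fin M → Bool) → Constraint → Set
    InProblem 𝓕 (fixed i j) = 𝓕 i j ≡ true
    InProblem 𝓕 _           = ⊤

    δ : {n : ℕ} → Fin n → Fin n → Carrier
    δ a a' = if ⌊ a ≟ a' ⌋ then 1# else 0#

    coef : Constraint → Fin k → Fin M → Carrier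
    coef (load i₀)     i j = δ i₀ i * fromℕ (t j)
    coef (card i₀)     i j = δ i₀ i
    coef (job j₀)      i j = δ j₀ j
    coef (fixed i₀ j₀) i j = δ i₀ i * δ j₀ j
    coef (nonneg i₀ j₀) i j = δ i₀ i * δ j₀ j

    rhs : (b : Fin k → Carrier) → Constraint → Carrier
    rhs b (load i)     = b i
    rhs b (card i)     = fromℕ (m i)
    rhs b (job j)      = 1#
    rhs b (fixed i j)  = 1#
    rhs b (nonneg i j) = 0#

    lhs : Constraint → (Fin k → Fin M → Carrier) → Carrier
    lhs con y = sum k (λ i → sum M (λ j → coef con i j * y i j))

    Tight : (b : Fin k → Carrier) → Constraint → (Fin k → Fin M → Carrier) → Set
    Tight b con y = lhs con y ≡ rhs b con

    LinearlyIndependent : List Constraint → Set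
    LinearlyIndependent S =
      ∀ (λs : Fin (length S) → Carrier) →
        (∀ i j → sum (length S) (λ l → λs l * coef (lookup S l) i j) ≡ 0#) →
        ∀ l → λs l ≡ 0#

    BasicSolution : (b : Fin k → Carrier) (𝓕 : Fin k → Fin M → Bool)
                    (x : Fin k → Fin M → Carrier) → Set
    BasicSolution b 𝓕 x =
      FeasibleSolution b 𝓕 x ×
      Σ (List Constraint) (λ S →
          (∀ {con} → con ∈ S → InProblem 𝓕 con)
        × (∀ {con} → con ∈ S → Tight b con x)
        × LinearlyIndependent S
        × (∀ y → (∀ {con} → con ∈ S → Tight b con y) → ∀ i j → y i j ≡ x i j))

  raise : {k M : ℕ} (t : Fin M → ℕ) (b : Fin k → Carrier) (p : Fin k) (q : Fin M) → Fin k → Carrier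
  raise t b p q i = if ⌊ i ≟ p ⌋ then b i + fromℕ (t q) else b i

-- Take a feasible solution x of Λ(b, 𝓕). If x_pq = 1, x itself solves Λ(b′, 𝓕′). Otherwise
-- d = 1 − x_pq > 0; let e be the indicator of row p of 𝓕′ and pass to the rank-one update
-- x′ = x + y wᵀ with y = x_p − e and w_i = (x_iq − δ_ip) / d. As w_p = −1, row p of x′ is e;
-- as Σ_i w_i = 0, every job stays fully assigned; every other machine has w_i ≥ 0 and trades
-- its share x_iq of q for the fraction x_iq / d of what p gives up. Now y_j ≥ 0 for j ≠ q and
-- y_j = 0 on jobs fixed in 𝓕, so Σ_j y_j ≤ 0 (p has free capacity 1, i.e. Σ_j e_j = m_p) and
-- Σ_j y_j t_j ≤ t_q Σ_j y_j ≤ 0 (t_q is maximal among free jobs): the other machines lose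
-- load and cardinality, while the load of p grows by at most t_q.

module Submission where

open import Defs
open import Algebra.Bundles using (CommutativeRing)
import Algebra.Properties.CommutativeSemigroup as CommutativeSemigroupProperties
import Algebra.Properties.Ring as RingProperties
open import Data.Bool as Bool using (Bool; true; false; _∨_; if_then_else_)
open import Data.Bool.Properties using (∨-identityʳ; ∨-zeroʳ; ¬-not)
open import Data.Fin using (Fin; zero; suc; _≟_)
open import Data.Fin.Properties using (suc-injective; any?)
open import Data.Nat as ℕ using (ℕ; zero; suc)
import Data.Nat.Properties as ℕₚ
open import Data.Product using (Σ; ∃; _×_; _,_; proj₁; proj₂)
open import Data.Sum using (_⊎_; inj₁; inj₂)
open import Function using (_∘_)
open import Relation.Binary.Bundles using (Poset)
open import Relation.Binary.PropositionalEquality as ≡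
  using (_≡_; _≢_; refl; sym; trans; cong; cong₂; subst; subst₂; module ≡-Reasoning)
import Relation.Binary.Reasoning.PartialOrder as PartialOrderReasoning
open import Relation.Nullary using (Dec; yes; no; contradiction)
open import Relation.Nullary.Decidable using (⌊_⌋)

⌊≟⌋-refl : ∀ {n} (a : Fin n) → ⌊ a ≟ a ⌋ ≡ true
⌊≟⌋-refl a with a ≟ a
... | yes _   = refl
... | no a≢a = contradiction refl a≢a

⌊≟⌋-≢ : ∀ {n} {a b : Fin n} → a ≢ b → ⌊ a ≟ b ⌋ ≡ false
⌊≟⌋-≢ {a = a} {b} a≢b with a ≟ b
... | yes a≡b = contradiction a≡b a≢b
... | no _    = refl

count-cong : ∀ n {P Q : Fin n → Bool} → (∀ i → P i ≡ Q i) → count n P ≡ count n Q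
count-cong zero    P≗Q = refl
count-cong (suc n) P≗Q =
  cong₂ (λ b r → (if b then 1 else 0) ℕ.+ r) (P≗Q zero) (count-cong n (P≗Q ∘ suc))

count-∨-single : ∀ n (P Q : Fin n → Bool) q → P q ≡ false → Q q ≡ true → (∀ j → j ≢ q → Q j ≡ false) →
                 count n (λ j → P j ∨ Q j) ≡ suc (count n P)
count-∨-single (suc n) P Q zero Pq Qq Q≢ rewrite Pq | Qq =
  cong suc (count-cong n (λ j → trans (cong (P (suc j) ∨_) (Q≢ (suc j) λ ())) (∨-identityʳ (P (suc j)))))
count-∨-single (suc n) P Q (suc q) Pq Qq Q≢ rewrite Q≢ zero (λ ()) | ∨-identityʳ (P zero) =
  trans (cong ((if P zero then 1 else 0) ℕ.+_)
              (count-∨-single n (P ∘ suc) (Q ∘ suc) q Pq Qq (λ j j≢q → Q≢ (suc j) (j≢q ∘ suc-injective))))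
        (ℕₚ.+-suc (if P zero then 1 else 0) _)

module _ {k M : ℕ} (𝓕 : Fin k → Fin M → Bool) where

  free-or-fixed : ∀ j → FreeJob 𝓕 j ⊎ ∃ λ i → 𝓕 i j ≡ true
  free-or-fixed j with any? (λ i → 𝓕 i j Bool.≟ true)
  ... | yes fixed = inj₂ fixed
  ... | no ¬fixed = inj₁ (λ i → ¬-not (λ 𝓕ij → ¬fixed (i , 𝓕ij)))

  addPair-≢ : ∀ {p q i} j → i ≢ p → addPair 𝓕 p q i j ≡ 𝓕 i j
  addPair-≢ j i≢p rewrite ⌊≟⌋-≢ i≢p = ∨-identityʳ _

  addPair-row : ∀ p q j → addPair 𝓕 p q p j ≡ 𝓕 p j ∨ ⌊ j ≟ q ⌋
  addPair-row p q j rewrite ⌊≟⌋-refl p = refl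

  addPair⇒ : ∀ {p q} i j → addPair 𝓕 p q i j ≡ true → 𝓕 i j ≡ true ⊎ (i ≡ p × j ≡ q)
  addPair⇒ {p} {q} i j h with 𝓕 i j | i ≟ p | j ≟ q
  ... | true  | _        | _        = inj₁ refl
  ... | false | yes i≡p  | yes j≡q  = inj₂ (i≡p , j≡q)
  ... | false | yes _    | no _     = contradiction h λ ()
  ... | false | no _     | _        = contradiction h λ ()

  count-addPair-row : ∀ p q → FreeJob 𝓕 q → count M (addPair 𝓕 p q p) ≡ suc (c 𝓕 p)
  count-addPair-row p q q-free = trans (count-cong M (addPair-row p q))
    (count-∨-single M (𝓕 p) (λ j → ⌊ j ≟ q ⌋) q (q-free p) (⌊≟⌋-refl q) (λ j → ⌊≟⌋-≢))

module OrderedFieldProperties (𝔽 : OrderedField) where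

  open OrderedField 𝔽 renaming (+-mono-≤ to +-monoˡ-≤)
  open BLPR 𝔽 using (fromℕ; sum)

  commutativeRing : CommutativeRing _ _
  commutativeRing = record { isCommutativeRing = isCommutativeRing }

  open CommutativeRing commutativeRing public
    using (_-_; +-assoc; +-comm; +-identityˡ; +-identityʳ; -‿inverseˡ; -‿inverseʳ;
           *-assoc; *-comm; *-identityˡ; distribˡ; distribʳ; zeroˡ; zeroʳ)
  open RingProperties (CommutativeRing.ring commutativeRing) public
    using (-‿distribʳ-*; -1*x≈-x; -‿involutive; -0#≈0#; x[y-z]≈xy-xz; ⁻¹-anti-homo‿-; xyx⁻¹≈y; x∙y⁻¹≈ε⇒x≈y)
  open CommutativeSemigroupProperties (CommutativeRing.+-commutativeSemigroup commutativeRing) public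
    using (interchange)

  ≡-dec : ∀ a b → Dec (a ≡ b)
  ≡-dec a b with trichotomy a b
  ... | inj₁ (_ , a≢b)        = no a≢b
  ... | inj₂ (inj₁ a≡b)       = yes a≡b
  ... | inj₂ (inj₂ (_ , b≢a)) = no (b≢a ∘ sym)

  x-[x-y]≡y : ∀ x y → x - (x - y) ≡ y
  x-[x-y]≡y x y = begin
    x + - (x - y)  ≡⟨ cong (x +_) (⁻¹-anti-homo‿- x y) ⟩
    x + (y - x)    ≡⟨ +-assoc x y (- x) ⟨
    x + y - x      ≡⟨ xyx⁻¹≈y x y ⟩
    y              ∎
    where open ≡-Reasoning

  x-0≡x : ∀ x → x - 0# ≡ x
  x-0≡x x = trans (cong (x +_) -0#≈0#) (+-identityʳ x)

  [x+yz]u≡xu+yuz : ∀ x y z u → (x + y * z) * u ≡ x * u + y * u * z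
  [x+yz]u≡xu+yuz x y z u = begin
    (x + y * z) * u    ≡⟨ distribʳ u x (y * z) ⟩
    x * u + y * z * u  ≡⟨ cong (x * u +_) (*-assoc y z u) ⟩
    x * u + y * (z * u) ≡⟨ cong (λ v → x * u + y * v) (*-comm z u) ⟩
    x * u + y * (u * z) ≡⟨ cong (x * u +_) (*-assoc y u z) ⟨
    x * u + y * u * z  ∎
    where open ≡-Reasoning

  x-y+y≡x : ∀ x y → x - y + y ≡ x
  x-y+y≡x x y = trans (+-assoc x (- y) y) (trans (cong (x +_) (-‿inverseˡ y)) (+-identityʳ x))

  x*-1≡-x : ∀ x → x * - 1# ≡ - x
  x*-1≡-x x = trans (*-comm x (- 1#)) (-1*x≈-x x)

  +-monoʳ-≤ : ∀ {x y} z → x ≤ y → z + x ≤ z + y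
  +-monoʳ-≤ {x} {y} z x≤y = subst₂ _≤_ (+-comm x z) (+-comm y z) (+-monoˡ-≤ z x≤y)

  +-mono-≤ : ∀ {a b c d} → a ≤ b → c ≤ d → a + c ≤ b + d
  +-mono-≤ {b = b} {c} a≤b c≤d = ≤-trans (+-monoˡ-≤ c a≤b) (+-monoʳ-≤ b c≤d)

  x≤y⇒0≤y-x : ∀ {x y} → x ≤ y → 0# ≤ y - x
  x≤y⇒0≤y-x {x} {y} x≤y = subst (_≤ y - x) (-‿inverseʳ x) (+-monoˡ-≤ (- x) x≤y)

  x≤y⇒x-y≤0 : ∀ {x y} → x ≤ y → x - y ≤ 0#
  x≤y⇒x-y≤0 {x} {y} x≤y = subst (x - y ≤_) (-‿inverseʳ y) (+-monoˡ-≤ (- y) x≤y)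

  x≤0⇒0≤-x : ∀ {x} → x ≤ 0# → 0# ≤ - x
  x≤0⇒0≤-x {x} x≤0 = subst₂ _≤_ (-‿inverseʳ x) (+-identityˡ (- x)) (+-monoˡ-≤ (- x) x≤0)

  0≤-x⇒x≤0 : ∀ {x} → 0# ≤ - x → x ≤ 0#
  0≤-x⇒x≤0 {x} 0≤-x = subst₂ _≤_ (+-identityˡ x) (-‿inverseˡ x) (+-monoˡ-≤ x 0≤-x)

  0≤y-x⇒x≤y : ∀ {x y} → 0# ≤ y - x → x ≤ y
  0≤y-x⇒x≤y {x} {y} 0≤y-x = subst₂ _≤_ (+-identityˡ x) (x-y+y≡x y x) (+-monoˡ-≤ x 0≤y-x)

  x+y≤x⇒y≤0 : ∀ {x y} → x + y ≤ x → y ≤ 0#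
  x+y≤x⇒y≤0 {x} {y} x+y≤x = subst₂ _≤_ (xyx⁻¹≈y x y) (-‿inverseʳ x) (+-monoˡ-≤ (- x) x+y≤x)

  y≤0⇒x+y≤x : ∀ {x y} → y ≤ 0# → x + y ≤ x
  y≤0⇒x+y≤x {x} {y} y≤0 = subst (x + y ≤_) (+-identityʳ x) (+-monoʳ-≤ x y≤0)

  0≤y⇒x≤x+y : ∀ {x y} → 0# ≤ y → x ≤ x + y
  0≤y⇒x≤x+y {x} {y} 0≤y = subst (_≤ x + y) (+-identityʳ x) (+-monoʳ-≤ x 0≤y)

  0≤1 : 0# ≤ 1#
  0≤1 with ≤-total 0# 1#
  ... | inj₁ 0≤1 = 0≤1
  ... | inj₂ 1≤0 = subst (0# ≤_) -1*-1≡1 (*-nonneg 0≤-1 0≤-1)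
    where
    0≤-1 : 0# ≤ - 1#
    0≤-1 = x≤0⇒0≤-x 1≤0
    -1*-1≡1 : - 1# * - 1# ≡ 1#
    -1*-1≡1 = trans (-1*x≈-x (- 1#)) (-‿involutive 1#)

  *-monoʳ-≤-nonNeg : ∀ {x y} z → 0# ≤ z → x ≤ y → z * x ≤ z * y
  *-monoʳ-≤-nonNeg {x} {y} z 0≤z x≤y =
    0≤y-x⇒x≤y (subst (0# ≤_) (x[y-z]≈xy-xz z y x) (*-nonneg 0≤z (x≤y⇒0≤y-x x≤y)))

  *-monoˡ-≤-nonNeg : ∀ {x y} z → 0# ≤ z → x ≤ y → x * z ≤ y * z
  *-monoˡ-≤-nonNeg {x} {y} z 0≤z x≤y = subst₂ _≤_ (*-comm z x) (*-comm z y) (*-monoʳ-≤-nonNeg z 0≤z x≤y)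

  *-nonpos : ∀ {x y} → 0# ≤ x → y ≤ 0# → x * y ≤ 0#
  *-nonpos {x} {y} 0≤x y≤0 = 0≤-x⇒x≤0 (subst (0# ≤_) (sym (-‿distribʳ-* x y)) (*-nonneg 0≤x (x≤0⇒0≤-x y≤0)))

  ⁻¹-nonneg : ∀ {x} → 0# ≤ x → x ≢ 0# → 0# ≤ x ⁻¹
  ⁻¹-nonneg {x} 0≤x x≢0 with ≤-total 0# (x ⁻¹)
  ... | inj₁ 0≤x⁻¹ = 0≤x⁻¹
  ... | inj₂ x⁻¹≤0 = contradiction (≤-antisym 0≤1 1≤0) 0≢1
    where
    1≤0 : 1# ≤ 0#
    1≤0 = subst (_≤ 0#) (⁻¹-inverse x x≢0) (*-nonpos 0≤x x⁻¹≤0)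

  fromℕ-nonneg : ∀ n → 0# ≤ fromℕ n
  fromℕ-nonneg zero    = ≤-refl
  fromℕ-nonneg (suc n) = subst (_≤ fromℕ (suc n)) (+-identityˡ 0#) (+-mono-≤ 0≤1 (fromℕ-nonneg n))

  fromℕ-mono-≤ : ∀ {m n} → m ℕ.≤ n → fromℕ m ≤ fromℕ n
  fromℕ-mono-≤ {n = n} ℕ.z≤n = fromℕ-nonneg n
  fromℕ-mono-≤ (ℕ.s≤s m≤n)   = +-monoʳ-≤ 1# (fromℕ-mono-≤ m≤n)

  poset : Poset _ _ _
  poset = record
    { isPartialOrder = record
      { isPreorder = record { isEquivalence = ≡.isEquivalence ; reflexive = λ { refl → ≤-refl } ; trans = ≤-trans }
      ; antisym    = ≤-antisym
      }
    }

  module ≤-Reasoning = PartialOrderReasoning poset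

  𝟙 : Bool → Carrier
  𝟙 true  = 1#
  𝟙 false = 0#

  𝟙-nonneg : ∀ b → 0# ≤ 𝟙 b
  𝟙-nonneg true  = 0≤1
  𝟙-nonneg false = ≤-refl

  𝟙*≤ : ∀ b {z} → 0# ≤ z → 𝟙 b * z ≤ z
  𝟙*≤ true  {z} _   = subst (_≤ z) (sym (*-identityˡ z)) ≤-refl
  𝟙*≤ false {z} 0≤z = subst (_≤ z) (sym (zeroˡ z)) 0≤z

  sum-cong : ∀ n {f g : Fin n → Carrier} → (∀ i → f i ≡ g i) → sum n f ≡ sum n g
  sum-cong zero    f≗g = refl
  sum-cong (suc n) f≗g = cong₂ _+_ (f≗g zero) (sum-cong n (f≗g ∘ suc))

  sum-zero : ∀ n → sum n (λ _ → 0#) ≡ 0#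
  sum-zero zero    = refl
  sum-zero (suc n) = trans (cong (0# +_) (sum-zero n)) (+-identityˡ 0#)

  sum-distrib-+ : ∀ n (f g : Fin n → Carrier) → sum n (λ i → f i + g i) ≡ sum n f + sum n g
  sum-distrib-+ zero    f g = sym (+-identityˡ 0#)
  sum-distrib-+ (suc n) f g =
    trans (cong (f zero + g zero +_) (sum-distrib-+ n (f ∘ suc) (g ∘ suc))) (interchange _ _ _ _)

  *-distribˡ-sum : ∀ n x (f : Fin n → Carrier) → x * sum n f ≡ sum n (λ i → x * f i)
  *-distribˡ-sum zero    x f = zeroʳ x
  *-distribˡ-sum (suc n) x f = trans (distribˡ x (f zero) _) (cong (x * f zero +_) (*-distribˡ-sum n x (f ∘ suc)))

  sum-distrib-- : ∀ n (f g : Fin n → Carrier) → sum n (λ i → f i - g i) ≡ sum n f - sum n g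
  sum-distrib-- n f g = begin
    sum n (λ i → f i - g i)              ≡⟨ sum-distrib-+ n f (λ i → - g i) ⟩
    sum n f + sum n (λ i → - g i)        ≡⟨ cong (sum n f +_) (sum-cong n (λ i → -1*x≈-x (g i))) ⟨
    sum n f + sum n (λ i → - 1# * g i)   ≡⟨ cong (sum n f +_) (*-distribˡ-sum n (- 1#) g) ⟨
    sum n f + - 1# * sum n g             ≡⟨ cong (sum n f +_) (-1*x≈-x (sum n g)) ⟩
    sum n f - sum n g                    ∎
    where open ≡-Reasoning

  sum-+-* : ∀ n (f g : Fin n → Carrier) w → sum n (λ i → f i + g i * w) ≡ sum n f + w * sum n g
  sum-+-* n f g w = begin
    sum n (λ i → f i + g i * w)   ≡⟨ sum-distrib-+ n f (λ i → g i * w) ⟩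
    sum n f + sum n (λ i → g i * w) ≡⟨ cong (sum n f +_) (sum-cong n (λ i → *-comm (g i) w)) ⟩
    sum n f + sum n (λ i → w * g i) ≡⟨ cong (sum n f +_) (*-distribˡ-sum n w g) ⟨
    sum n f + w * sum n g         ∎
    where open ≡-Reasoning

  sum-mono-≤ : ∀ n {f g : Fin n → Carrier} → (∀ i → f i ≤ g i) → sum n f ≤ sum n g
  sum-mono-≤ zero    f≤g = ≤-refl
  sum-mono-≤ (suc n) f≤g = +-mono-≤ (f≤g zero) (sum-mono-≤ n (f≤g ∘ suc))

  sum-𝟙 : ∀ n (P : Fin n → Bool) → sum n (𝟙 ∘ P) ≡ fromℕ (count n P)
  sum-𝟙 zero    P = refl
  sum-𝟙 (suc n) P with P zero
  ... | true  = cong (1# +_) (sum-𝟙 n (P ∘ suc))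
  ... | false = trans (+-identityˡ _) (sum-𝟙 n (P ∘ suc))

  sum-single : ∀ n (a : Fin n) (f : Fin n → Carrier) → (∀ i → i ≢ a → f i ≡ 0#) → sum n f ≡ f a
  sum-single (suc n) zero    f f≡0 =
    trans (cong (f zero +_) (trans (sum-cong n (λ i → f≡0 (suc i) λ ())) (sum-zero n))) (+-identityʳ (f zero))
  sum-single (suc n) (suc a) f f≡0 =
    trans (cong₂ _+_ (f≡0 zero λ ()) (sum-single n a (f ∘ suc) (λ i i≢a → f≡0 (suc i) (i≢a ∘ suc-injective))))
          (+-identityˡ _)

  δ : ∀ {n} → Fin n → Fin n → Carrier
  δ a i = 𝟙 ⌊ i ≟ a ⌋

  δ-refl : ∀ {n} (a : Fin n) → δ a a ≡ 1#
  δ-refl a = cong 𝟙 (⌊≟⌋-refl a)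

  δ-≢ : ∀ {n} {a i : Fin n} → i ≢ a → δ a i ≡ 0#
  δ-≢ i≢a = cong 𝟙 (⌊≟⌋-≢ i≢a)

  sum-δ : ∀ n (a : Fin n) → sum n (δ a) ≡ 1#
  sum-δ n a = trans (sum-single n a (δ a) (λ i → δ-≢)) (δ-refl a)

  sum-δ* : ∀ n (a : Fin n) (f : Fin n → Carrier) → sum n (λ i → δ a i * f i) ≡ f a
  sum-δ* n a f = begin
    sum n (λ i → δ a i * f i) ≡⟨ sum-single n a _ (λ i i≢a → trans (cong (_* f i) (δ-≢ i≢a)) (zeroˡ (f i))) ⟩
    δ a a * f a               ≡⟨ cong (_* f a) (δ-refl a) ⟩
    1# * f a                  ≡⟨ *-identityˡ (f a) ⟩
    f a                       ∎
    where open ≡-Reasoning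

  ≤-sum : ∀ n (f : Fin n → Carrier) → (∀ i → 0# ≤ f i) → ∀ a → f a ≤ sum n f
  ≤-sum n f f≥0 a = subst (_≤ sum n f) (sum-δ* n a f) (sum-mono-≤ n (λ i → 𝟙*≤ ⌊ i ≟ a ⌋ (f≥0 i)))

  +-≤-sum : ∀ n (f : Fin n → Carrier) → (∀ i → 0# ≤ f i) → ∀ {a b} → a ≢ b → f a + f b ≤ sum n f
  +-≤-sum n f f≥0 {a} {b} a≢b =
    subst (_≤ sum n f) (trans (sum-distrib-+ n _ _) (cong₂ _+_ (sum-δ* n a f) (sum-δ* n b f)))
          (sum-mono-≤ n (λ i → pointwise i (i ≟ a)))
    where
    open ≤-Reasoning
    pointwise : ∀ i → Dec (i ≡ a) → δ a i * f i + δ b i * f i ≤ f i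
    pointwise i (yes refl) = begin
      δ a a * f a + δ b a * f a  ≡⟨ cong₂ (λ u v → u * f a + v * f a) (δ-refl a) (δ-≢ a≢b) ⟩
      1# * f a + 0# * f a        ≡⟨ cong₂ _+_ (*-identityˡ (f a)) (zeroˡ (f a)) ⟩
      f a + 0#                   ≡⟨ +-identityʳ (f a) ⟩
      f a                        ∎
    pointwise i (no i≢a)   = begin
      δ a i * f i + δ b i * f i  ≡⟨ cong (λ u → u * f i + δ b i * f i) (δ-≢ i≢a) ⟩
      0# * f i + δ b i * f i     ≡⟨ trans (cong (_+ δ b i * f i) (zeroˡ (f i))) (+-identityˡ (δ b i * f i)) ⟩
      δ b i * f i                ≤⟨ 𝟙*≤ ⌊ i ≟ b ⌋ (f≥0 i) ⟩
      f i                        ∎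

module Feasibility (𝔽 : OrderedField) where

  open OrderedField 𝔽 renaming (+-mono-≤ to +-monoˡ-≤)
  open OrderedFieldProperties 𝔽
  open BLPR 𝔽 using (fromℕ; sum; FeasibleSolution; Feasible; raise)

  module _ {k M : ℕ} (t : Fin M → ℕ) (b : Fin k → Carrier) (p : Fin k) (q : Fin M) where

    raise-≡ : raise t b p q p ≡ b p + fromℕ (t q)
    raise-≡ rewrite ⌊≟⌋-refl p = refl

    raise-≢ : ∀ {i} → i ≢ p → raise t b p q i ≡ b i
    raise-≢ i≢p rewrite ⌊≟⌋-≢ i≢p = refl

    ≤-raise : ∀ i → b i ≤ raise t b p q i
    ≤-raise i with i ≟ p
    ... | yes refl = 0≤y⇒x≤x+y (fromℕ-nonneg (t q))
    ... | no _     = ≤-refl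

  module FeasibleSolutionProperties {k M : ℕ} {m : Fin k → ℕ} {t : Fin M → ℕ} {b : Fin k → Carrier}
           {𝓕 : Fin k → Fin M → Bool} {x : Fin k → Fin M → Carrier} (feasible : FeasibleSolution m t b 𝓕 x) where

    load-≤ : ∀ i → sum M (λ j → x i j * fromℕ (t j)) ≤ b i
    load-≤ = proj₁ feasible

    card-≤ : ∀ i → sum M (x i) ≤ fromℕ (m i)
    card-≤ = proj₁ (proj₂ feasible)

    job-sum : ∀ j → sum k (λ i → x i j) ≡ 1#
    job-sum = proj₁ (proj₂ (proj₂ feasible))

    fixed-≡1 : ∀ i j → 𝓕 i j ≡ true → x i j ≡ 1#
    fixed-≡1 = proj₁ (proj₂ (proj₂ (proj₂ feasible)))

    entry-nonneg : ∀ i j → 0# ≤ x i j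
    entry-nonneg = proj₂ (proj₂ (proj₂ (proj₂ feasible)))

    entry-≤1 : ∀ i j → x i j ≤ 1#
    entry-≤1 i j = subst (x i j ≤_) (job-sum j) (≤-sum k (λ l → x l j) (λ l → entry-nonneg l j) i)

    fixed-excludes : ∀ {i i′ j} → 𝓕 i j ≡ true → i′ ≢ i → x i′ j ≡ 0#
    fixed-excludes {i} {i′} {j} 𝓕ij i′≢i = ≤-antisym (x+y≤x⇒y≤0 1+xi′j≤1) (entry-nonneg i′ j)
      where
      1+xi′j≤1 : 1# + x i′ j ≤ 1#
      1+xi′j≤1 = subst₂ (λ u v → u + x i′ j ≤ v) (fixed-≡1 i j 𝓕ij) (job-sum j)
                        (+-≤-sum k (λ l → x l j) (λ l → entry-nonneg l j) (i′≢i ∘ sym))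

  feasible-if-xpq≡1 : ∀ {k M} {m : Fin k → ℕ} {t : Fin M → ℕ} {b} {𝓕} {x} → FeasibleSolution m t b 𝓕 x →
                 ∀ p q → x p q ≡ 1# → FeasibleSolution m t (raise t b p q) (addPair 𝓕 p q) x
  feasible-if-xpq≡1 {t = t} {b} {𝓕} {x} (load , card , job , fixed , nonneg) p q xpq≡1 =
    (λ i → ≤-trans (load i) (≤-raise t b p q i)) , card , job , fixed′ , nonneg
    where
    fixed′ : ∀ i j → addPair 𝓕 p q i j ≡ true → x i j ≡ 1#
    fixed′ i j h with addPair⇒ 𝓕 i j h
    ... | inj₁ 𝓕ij           = fixed i j 𝓕ij
    ... | inj₂ (refl , refl) = xpq≡1

  module Exchange {k M : ℕ} (m : Fin k → ℕ) (t : Fin M → ℕ) {b : Fin k → Carrier} {𝓕 : Fin k → Fin M → Bool}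
    {x : Fin k → Fin M → Carrier} (feasible : FeasibleSolution m t b 𝓕 x)
    {p : Fin k} (p-capacity : m p ≡ c 𝓕 p ℕ.+ 1)
    {q : Fin M} (q-free : FreeJob 𝓕 q) (q-longest : ∀ j → FreeJob 𝓕 j → t j ℕ.≤ t q)
    (xpq≢1 : x p q ≢ 1#) where

    open FeasibleSolutionProperties {m = m} {t = t} feasible

    T : Fin M → Carrier
    T j = fromℕ (t j)

    e : Fin M → Carrier
    e j = 𝟙 (addPair 𝓕 p q p j)

    y : Fin M → Carrier
    y j = x p j - e j

    d : Carrier
    d = 1# - x p q

    w : Fin k → Carrier
    w i = d ⁻¹ * (x i q - δ p i)

    x′ : Fin k → Fin M → Carrier
    x′ i j = x i j + y j * w i

    d≢0 : d ≢ 0#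
    d≢0 d≡0 = xpq≢1 (sym (x∙y⁻¹≈ε⇒x≈y 1# (x p q) d≡0))

    d⁻¹*[xpq-1]≡-1 : d ⁻¹ * (x p q - 1#) ≡ - 1#
    d⁻¹*[xpq-1]≡-1 = begin
      d ⁻¹ * (x p q - 1#) ≡⟨ cong (d ⁻¹ *_) (⁻¹-anti-homo‿- 1# (x p q)) ⟨
      d ⁻¹ * - d          ≡⟨ -‿distribʳ-* (d ⁻¹) d ⟨
      - (d ⁻¹ * d)        ≡⟨ cong -_ (trans (*-comm (d ⁻¹) d) (⁻¹-inverse d d≢0)) ⟩
      - 1#                ∎
      where open ≡-Reasoning

    w-p : w p ≡ - 1#
    w-p = trans (cong (λ z → d ⁻¹ * (x p q - z)) (δ-refl p)) d⁻¹*[xpq-1]≡-1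

    w-≢ : ∀ {i} → i ≢ p → w i ≡ d ⁻¹ * x i q
    w-≢ {i} i≢p = cong (d ⁻¹ *_) (trans (cong (λ z → x i q - z) (δ-≢ i≢p)) (x-0≡x (x i q)))

    w-nonneg : ∀ {i} → i ≢ p → 0# ≤ w i
    w-nonneg {i} i≢p = subst (0# ≤_) (sym (w-≢ i≢p))
      (*-nonneg (⁻¹-nonneg (x≤y⇒0≤y-x (entry-≤1 p q)) d≢0) (entry-nonneg i q))

    sum-w : sum k w ≡ 0#
    sum-w = begin
      sum k w                                     ≡⟨ *-distribˡ-sum k (d ⁻¹) (λ i → x i q - δ p i) ⟨
      d ⁻¹ * sum k (λ i → x i q - δ p i)          ≡⟨ cong (d ⁻¹ *_) (sum-distrib-- k (λ i → x i q) (δ p)) ⟩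
      d ⁻¹ * (sum k (λ i → x i q) - sum k (δ p))  ≡⟨ cong₂ (λ u v → d ⁻¹ * (u - v)) (job-sum q) (sum-δ k p) ⟩
      d ⁻¹ * (1# - 1#)                            ≡⟨ cong (d ⁻¹ *_) (-‿inverseʳ 1#) ⟩
      d ⁻¹ * 0#                                   ≡⟨ zeroʳ (d ⁻¹) ⟩
      0#                                          ∎
      where open ≡-Reasoning

    e-q : e q ≡ 1#
    e-q = cong 𝟙 (trans (addPair-row 𝓕 p q q) (trans (cong (𝓕 p q ∨_) (⌊≟⌋-refl q)) (∨-zeroʳ (𝓕 p q))))

    e-≢ : ∀ {j} → j ≢ q → e j ≡ 𝟙 (𝓕 p j)
    e-≢ {j} j≢q = cong 𝟙 (trans (addPair-row 𝓕 p q j) (trans (cong (𝓕 p j ∨_) (⌊≟⌋-≢ j≢q)) (∨-identityʳ (𝓕 p j))))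

    sum-e : sum M e ≡ fromℕ (m p)
    sum-e = begin
      sum M e                              ≡⟨ sum-𝟙 M (addPair 𝓕 p q p) ⟩
      fromℕ (count M (addPair 𝓕 p q p))   ≡⟨ cong fromℕ (count-addPair-row 𝓕 p q q-free) ⟩
      fromℕ (suc (c 𝓕 p))                  ≡⟨ cong fromℕ (trans (ℕₚ.+-comm 1 (c 𝓕 p)) (sym p-capacity)) ⟩
      fromℕ (m p)                          ∎
      where open ≡-Reasoning

    x′-row-p : ∀ j → x′ p j ≡ e j
    x′-row-p j = begin
      x p j + y j * w p     ≡⟨ cong (λ z → x p j + y j * z) w-p ⟩
      x p j + y j * - 1#    ≡⟨ cong (x p j +_) (x*-1≡-x (y j)) ⟩
      x p j - (x p j - e j) ≡⟨ x-[x-y]≡y (x p j) (e j) ⟩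
      e j                   ∎
      where open ≡-Reasoning

    x′-column-q : ∀ {i} → i ≢ p → x′ i q ≡ 0#
    x′-column-q {i} i≢p = begin
      x i q + y q * w i                             ≡⟨ cong₂ (λ u v → x i q + (x p q - u) * v) e-q (w-≢ i≢p) ⟩
      x i q + (x p q - 1#) * (d ⁻¹ * x i q)         ≡⟨ cong (x i q +_) (*-assoc (x p q - 1#) (d ⁻¹) (x i q)) ⟨
      x i q + (x p q - 1#) * d ⁻¹ * x i q           ≡⟨ cong (λ z → x i q + z * x i q) (*-comm (x p q - 1#) (d ⁻¹)) ⟩
      x i q + d ⁻¹ * (x p q - 1#) * x i q           ≡⟨ cong (λ z → x i q + z * x i q) d⁻¹*[xpq-1]≡-1 ⟩
      x i q + - 1# * x i q                          ≡⟨ cong (x i q +_) (-1*x≈-x (x i q)) ⟩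
      x i q - x i q                                 ≡⟨ -‿inverseʳ (x i q) ⟩
      0#                                            ∎
      where open ≡-Reasoning

    e≤x : ∀ {j} → j ≢ q → e j ≤ x p j
    e≤x {j} j≢q = subst (_≤ x p j) (sym (e-≢ j≢q)) (𝟙≤x (𝓕 p j) refl)
      where
      𝟙≤x : ∀ β → 𝓕 p j ≡ β → 𝟙 β ≤ x p j
      𝟙≤x true  𝓕pj = subst (1# ≤_) (sym (fixed-≡1 p j 𝓕pj)) ≤-refl
      𝟙≤x false _   = entry-nonneg p j

    y-nonneg : ∀ {j} → j ≢ q → 0# ≤ y j
    y-nonneg j≢q = x≤y⇒0≤y-x (e≤x j≢q)

    fixed⇒≢q : ∀ {i j} → 𝓕 i j ≡ true → j ≢ q
    fixed⇒≢q {i} 𝓕ij refl = contradiction (trans (sym 𝓕ij) (q-free i)) λ ()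

    y-fixed : ∀ {i j} → 𝓕 i j ≡ true → y j ≡ 0#
    y-fixed {i} {j} 𝓕ij with i ≟ p
    ... | yes refl = trans (cong₂ _-_ (fixed-≡1 p j 𝓕ij) (trans (e-≢ (fixed⇒≢q 𝓕ij)) (cong 𝟙 𝓕ij)))
                           (-‿inverseʳ 1#)
    ... | no i≢p   = ≤-antisym y≤0 (y-nonneg (fixed⇒≢q 𝓕ij))
      where
      y≤0 : y j ≤ 0#
      y≤0 = subst (λ z → z - e j ≤ 0#) (sym (fixed-excludes 𝓕ij (i≢p ∘ sym))) (x≤y⇒x-y≤0 (𝟙-nonneg (addPair 𝓕 p q p j)))

    -- Case splits on j ≟ q and i ≟ p go through helpers taking a Dec rather than `with`, which
    -- would also abstract the occurrences hidden inside e, w and raise.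
    yT≤yTq : ∀ j → y j * T j ≤ y j * T q
    yT≤yTq j = by-cases (j ≟ q) (free-or-fixed 𝓕 j)
      where
      by-cases : Dec (j ≡ q) → FreeJob 𝓕 j ⊎ ∃ (λ i → 𝓕 i j ≡ true) → y j * T j ≤ y j * T q
      by-cases (yes refl) _                = ≤-refl
      by-cases (no j≢q)   (inj₁ j-free)    = *-monoʳ-≤-nonNeg (y j) (y-nonneg j≢q) (fromℕ-mono-≤ (q-longest j j-free))
      by-cases (no _)     (inj₂ (_ , 𝓕ij)) = subst (λ z → z * T j ≤ z * T q) (sym (y-fixed 𝓕ij))
                                                   (subst₂ _≤_ (sym (zeroˡ (T j))) (sym (zeroˡ (T q))) ≤-refl)

    sum-y≤0 : sum M y ≤ 0#
    sum-y≤0 = subst (_≤ 0#) (sym (trans (sum-distrib-- M (x p) e) (cong (λ z → sum M (x p) - z) sum-e)))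
                    (x≤y⇒x-y≤0 (card-≤ p))

    sum-yT≤0 : sum M (λ j → y j * T j) ≤ 0#
    sum-yT≤0 = begin
      sum M (λ j → y j * T j) ≤⟨ sum-mono-≤ M yT≤yTq ⟩
      sum M (λ j → y j * T q) ≡⟨ sum-cong M (λ j → *-comm (y j) (T q)) ⟩
      sum M (λ j → T q * y j) ≡⟨ *-distribˡ-sum M (T q) y ⟨
      T q * sum M y           ≤⟨ *-nonpos (fromℕ-nonneg (t q)) sum-y≤0 ⟩
      0#                      ∎
      where open ≤-Reasoning

    eT≤xT+δT : ∀ j → e j * T j ≤ x p j * T j + δ q j * T q
    eT≤xT+δT j = by-cases (j ≟ q)
      where
      open ≤-Reasoning
      by-cases : Dec (j ≡ q) → e j * T j ≤ x p j * T j + δ q j * T q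
      by-cases (yes refl) = begin
        e q * T q                  ≡⟨ trans (cong (_* T q) e-q) (*-identityˡ (T q)) ⟩
        T q                        ≤⟨ 0≤y⇒x≤x+y (*-nonneg (entry-nonneg p q) (fromℕ-nonneg (t q))) ⟩
        T q + x p q * T q          ≡⟨ +-comm (T q) (x p q * T q) ⟩
        x p q * T q + T q          ≡⟨ cong (x p q * T q +_) (trans (cong (_* T q) (δ-refl q)) (*-identityˡ (T q))) ⟨
        x p q * T q + δ q q * T q  ∎
      by-cases (no j≢q)   = begin
        e j * T j                  ≤⟨ *-monoˡ-≤-nonNeg (T j) (fromℕ-nonneg (t j)) (e≤x j≢q) ⟩
        x p j * T j                ≡⟨ +-identityʳ (x p j * T j) ⟨
        x p j * T j + 0#           ≡⟨ cong (x p j * T j +_) (trans (cong (_* T q) (δ-≢ j≢q)) (zeroˡ (T q))) ⟨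
        x p j * T j + δ q j * T q  ∎

    load′ : ∀ i → sum M (λ j → x′ i j * T j) ≤ raise t b p q i
    load′ i = by-cases (i ≟ p)
      where
      open ≤-Reasoning
      by-cases : Dec (i ≡ p) → sum M (λ j → x′ i j * T j) ≤ raise t b p q i
      by-cases (yes refl) = begin
        sum M (λ j → x′ p j * T j)                             ≡⟨ sum-cong M (λ j → cong (_* T j) (x′-row-p j)) ⟩
        sum M (λ j → e j * T j)                                ≤⟨ sum-mono-≤ M eT≤xT+δT ⟩
        sum M (λ j → x p j * T j + δ q j * T q)                ≡⟨ sum-distrib-+ M (λ j → x p j * T j) (λ j → δ q j * T q) ⟩
        sum M (λ j → x p j * T j) + sum M (λ j → δ q j * T q)  ≡⟨ cong (sum M (λ j → x p j * T j) +_) (sum-δ* M q (λ _ → T q)) ⟩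
        sum M (λ j → x p j * T j) + T q                        ≤⟨ +-monoˡ-≤ (T q) (load-≤ p) ⟩
        b p + T q                                              ≡⟨ raise-≡ t b p q ⟨
        raise t b p q p                                        ∎
      by-cases (no i≢p)   = begin
        sum M (λ j → x′ i j * T j)                              ≡⟨ sum-cong M (λ j → [x+yz]u≡xu+yuz (x i j) (y j) (w i) (T j)) ⟩
        sum M (λ j → x i j * T j + y j * T j * w i)             ≡⟨ sum-+-* M (λ j → x i j * T j) (λ j → y j * T j) (w i) ⟩
        sum M (λ j → x i j * T j) + w i * sum M (λ j → y j * T j) ≤⟨ y≤0⇒x+y≤x (*-nonpos (w-nonneg i≢p) sum-yT≤0) ⟩
        sum M (λ j → x i j * T j)                               ≤⟨ load-≤ i ⟩
        b i                                                     ≡⟨ raise-≢ t b p q i≢p ⟨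
        raise t b p q i                                         ∎

    card′ : ∀ i → sum M (x′ i) ≤ fromℕ (m i)
    card′ i = by-cases (i ≟ p)
      where
      open ≤-Reasoning
      by-cases : Dec (i ≡ p) → sum M (x′ i) ≤ fromℕ (m i)
      by-cases (yes refl) = begin
        sum M (x′ p)                 ≡⟨ sum-cong M x′-row-p ⟩
        sum M e                      ≡⟨ sum-e ⟩
        fromℕ (m p)                  ∎
      by-cases (no i≢p)   = begin
        sum M (x′ i)                 ≡⟨ sum-+-* M (x i) y (w i) ⟩
        sum M (x i) + w i * sum M y  ≤⟨ y≤0⇒x+y≤x (*-nonpos (w-nonneg i≢p) sum-y≤0) ⟩
        sum M (x i)                  ≤⟨ card-≤ i ⟩
        fromℕ (m i)                  ∎

    job′ : ∀ j → sum k (λ i → x′ i j) ≡ 1#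
    job′ j = begin
      sum k (λ i → x i j + y j * w i)               ≡⟨ sum-distrib-+ k (λ i → x i j) (λ i → y j * w i) ⟩
      sum k (λ i → x i j) + sum k (λ i → y j * w i) ≡⟨ cong₂ _+_ (job-sum j) (sym (*-distribˡ-sum k (y j) w)) ⟩
      1# + y j * sum k w                            ≡⟨ cong (λ z → 1# + y j * z) sum-w ⟩
      1# + y j * 0#                                 ≡⟨ cong (1# +_) (zeroʳ (y j)) ⟩
      1# + 0#                                       ≡⟨ +-identityʳ 1# ⟩
      1#                                            ∎
      where open ≡-Reasoning

    fixed′ : ∀ i j → addPair 𝓕 p q i j ≡ true → x′ i j ≡ 1#
    fixed′ i j h = by-cases (i ≟ p)
      where
      open ≡-Reasoning
      by-cases : Dec (i ≡ p) → x′ i j ≡ 1#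
      by-cases (yes refl) = trans (x′-row-p j) (cong 𝟙 h)
      by-cases (no i≢p)   = begin
        x i j + y j * w i  ≡⟨ cong (λ z → x i j + z * w i) (y-fixed 𝓕ij) ⟩
        x i j + 0# * w i   ≡⟨ cong (x i j +_) (zeroˡ (w i)) ⟩
        x i j + 0#         ≡⟨ +-identityʳ (x i j) ⟩
        x i j              ≡⟨ fixed-≡1 i j 𝓕ij ⟩
        1#                 ∎
        where
        𝓕ij : 𝓕 i j ≡ true
        𝓕ij = trans (sym (addPair-≢ 𝓕 j i≢p)) h

    nonneg′ : ∀ i j → 0# ≤ x′ i j
    nonneg′ i j = by-cases (i ≟ p) (j ≟ q)
      where
      by-cases : Dec (i ≡ p) → Dec (j ≡ q) → 0# ≤ x′ i j
      by-cases (yes refl) _          = subst (0# ≤_) (sym (x′-row-p j)) (𝟙-nonneg (addPair 𝓕 p q p j))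
      by-cases (no i≢p)   (yes refl) = subst (0# ≤_) (sym (x′-column-q i≢p)) ≤-refl
      by-cases (no i≢p)   (no j≢q)   = subst (_≤ x′ i j) (+-identityˡ 0#)
        (+-mono-≤ (entry-nonneg i j) (*-nonneg (y-nonneg j≢q) (w-nonneg i≢p)))

    feasible′ : FeasibleSolution m t (raise t b p q) (addPair 𝓕 p q) x′
    feasible′ = load′ , card′ , job′ , fixed′ , nonneg′

  raise-feasible : ∀ {k M} (m : Fin k → ℕ) (t : Fin M → ℕ) {b : Fin k → Carrier} {𝓕 : Fin k → Fin M → Bool}
    {x : Fin k → Fin M → Carrier} → FeasibleSolution m t b 𝓕 x →
    ∀ {p} → m p ≡ c 𝓕 p ℕ.+ 1 → ∀ {q} → FreeJob 𝓕 q → (∀ j → FreeJob 𝓕 j → t j ℕ.≤ t q) →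
    Feasible m t (raise t b p q) (addPair 𝓕 p q)
  raise-feasible m t {x = x} feasible {p} p-capacity {q} q-free q-longest with ≡-dec (x p q) 1#
  ... | yes xpq≡1 = x , feasible-if-xpq≡1 {m = m} {t = t} feasible p q xpq≡1
  ... | no xpq≢1  = Exchange.x′ m t feasible p-capacity q-free q-longest xpq≢1
                  , Exchange.feasible′ m t feasible p-capacity q-free q-longest xpq≢1

open BLPR
open import Data.Nat using (_≤_; _<_; _+_; _*_)

theorem2 : (𝔽 : OrderedField) →
    (k M : ℕ) → 1 ≤ k →
    (m : Fin k → ℕ) → (∀ i → 1 ≤ m i) →
    (t : Fin M → ℕ) → M ≤ sumℕ k m →
    (b : Fin k → OrderedField.Carrier 𝔽) → (𝓕 : Fin k → Fin M → Bool) →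
    M* 𝓕 < 2 * k* 𝓕 m →
    Σ (Fin k → Fin M → OrderedField.Carrier 𝔽) (BasicSolution 𝔽 m t b 𝓕) →
    (p : Fin k) → m p ≡ c 𝓕 p + 1 →
    (q : Fin M) → FreeJob 𝓕 q → (∀ j → FreeJob 𝓕 j → t j ≤ t q) →
    Feasible 𝔽 m t b 𝓕 →
    Feasible 𝔽 m t (raise 𝔽 t b p q) (addPair 𝓕 p q)
theorem2 𝔽 _ _ _ m _ t _ _ _ _ _ _ p-capacity _ q-free q-longest (_ , feasible) =
  Feasibility.raise-feasible 𝔽 m t feasible p-capacity q-free q-longest
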